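{- Consider the Static Black-Peg AB Game with $p=2$ pegs and $c\ge 2$ colors. Then: (a) For each feasible strategy and each peg $i\in\{1,2\}$, there is at most one color that does not occur on peg $i$. (b) A feasible strategy cannot contain two disjoint $(1,1)$-questions. (c) If a feasible strategy contains three $(1,1)$-questions, then there is a permutation $\pi$ of the colors such that applying $\pi$ to every color maps these three questions to $(1\,|\,2)$, $(2\,|\,3)$, $(3\,|\,1)$. (d) If a feasible strategy contains three $(1,1)$-questions, then on at least one of the two pegs all $c$ colors occur. (e) A feasible strategy cannot contain four $(1,1)$-questions.
   Context: Static Black-Peg AB Game with $p$ pegs and $c\ge p$ colors $1,\dots,c$: secrets and questions are ordered $p$-tuples $(x_1\,|\,\dots\,|\,x_p)$ of pairwise distinct colors; the answer to question $Q$ for secret $S$ is the number of positions $i$ with $q_i=s_i$. A strategy is a list of pairwise distinct questions asked all at once; it is feasible if any two distinct secrets receive different vectors of answers. A color occurs on peg $i$ if it is the $i$-th entry of some question of the strategy. Two questions $Q=(q_1|\dots|q_p)$, $Q'=(q'_1|\dots|q'_p)$ are disjoint if $q_i\ne q'_j$ for all $i,j$. For a question $Q=(q_1|\dots|q_p)$ of a strategy, $Q$ is an $(a_1,\dots,a_p)$-question if for each $i$ the color $q_i$ occurs exactly $a_i$ times as the $i$-th entry among all questions of the strategy (including $Q$ itself). -}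

module Defs where

open import Data.Nat using (ℕ; zero; suc; _+_; _≤_; _<_; s≤s; z≤n)
open import Data.Nat.Properties using (≤-trans)
open import Data.Fin using (Fin; fromℕ<)
open import Data.Fin.Properties using (_≟_)
open import Data.Vec using (Vec; []; _∷_; lookup)
open import Data.List using (List; []; _∷_; length; filter; map)
open import Data.List.Membership.Propositional using (_∈_)
open import Data.List.Relation.Unary.All using (All)
open import Data.List.Relation.Unary.Any using (Any)
import Data.List.Relation.Unary.Unique.Propositional as LU
import Data.Vec.Relation.Unary.Unique.Propositional as VU
open import Relation.Binary.PropositionalEquality using (_≡_; _≢_)
open import Relation.Nullary using (¬_; does)
open import Data.Bool using (if_then_else_)

-- Colors 1..c are represented by Fin c (color k ↔ index k-1); pegs 1..p by Fin p.
-- A "code" (question or secret) is an ordered p-tuple of colors.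
Code : ℕ → ℕ → Set
Code p c = Vec (Fin c) p

ValidCode : ∀ {p c} → Code p c → Set
ValidCode q = VU.Unique q

answer : ∀ {p c} → Code p c → Code p c → ℕ
answer [] [] = 0
answer (x ∷ q) (y ∷ s) = (if does (x ≟ y) then 1 else 0) + answer q s

IsStrategy : ∀ {p c} → List (Code p c) → Set
IsStrategy S = All ValidCode S × LU.Unique S
  where open import Data.Product using (_×_)

Feasible : ∀ {p c} → List (Code p c) → Set
Feasible {p} {c} S = (s s' : Code p c) → ValidCode s → ValidCode s' →
  map (λ q → answer q s) S ≡ map (λ q → answer q s') S → s ≡ s'

Occurs : ∀ {p c} → List (Code p c) → Fin p → Fin c → Set
Occurs S i x = Any (λ q → lookup q i ≡ x) S

count : ∀ {p c} → List (Code p c) → Fin p → Fin c → ℕ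
count S i x = length (filter (λ q → lookup q i ≟ x) S)

IsTypeQuestion : ∀ {p c} → List (Code p c) → Vec ℕ p → Code p c → Set
IsTypeQuestion {p} S a q = q ∈ S × ((i : Fin p) → count S i (lookup q i) ≡ lookup a i)
  where open import Data.Product using (_×_)

Is11 : ∀ {c} → List (Code 2 c) → Code 2 c → Set
Is11 S q = IsTypeQuestion S (1 ∷ 1 ∷ []) q

Disjoint : ∀ {p c} → Code p c → Code p c → Set
Disjoint {p} q q' = (i j : Fin p) → lookup q i ≢ lookup q' j

col1 col2 col3 : ∀ {c} → 3 ≤ c → Fin c
col1 h = fromℕ< (≤-trans (s≤s z≤n) h)
col2 h = fromℕ< (≤-trans (s≤s (s≤s z≤n)) h)
col3 h = fromℕ< h

q12 q23 q31 : ∀ {c} → 3 ≤ c → Code 2 c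
q12 h = col1 h ∷ col2 h ∷ []
q23 h = col2 h ∷ col3 h ∷ []
q31 h = col3 h ∷ col1 h ∷ []

{-# OPTIONS --safe #-}
-- With two pegs the answer to (u|v) for the secret (x|y) is [u = x] + [v = y].  If (a|b) is
-- a (1,1)-question, a question (u|v) of the strategy has u = a iff it is (a|b) iff v = b, so
-- [u = a] = [v = b].  Hence, for two disjoint (1,1)-questions (a|b) and (a'|b'), the secrets
-- (a|b') and (a'|b) receive the same answers; likewise two colors missing from the same peg
-- can be exchanged in a secret.  So any two (1,1)-questions are linked (the second color of
-- one is the first color of the other), three of them form a cycle (a|b), (b|d), (d|a), and
-- no fourth one can be linked to all three.
module Submission where

open import Defs
open import Data.Nat using (ℕ; _≤_)
open import Data.Fin using (Fin)
open import Data.Fin.Permutation using (Permutation′; _⟨$⟩ʳ_)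
open import Data.Vec using (Vec; []; _∷_)
open import Data.List using (List; []; _∷_; map)
open import Data.List.Relation.Binary.Permutation.Propositional using (_↭_)
open import Data.Product using (_×_; Σ; ∃; _,_)
open import Data.Sum using (_⊎_)
open import Relation.Binary.PropositionalEquality using (_≡_; _≢_)
open import Relation.Nullary using (¬_)
open import Data.Empty using (⊥)

open import Data.Nat using (_+_)
open import Data.Nat.Properties using (+-comm; +-identityʳ)
open import Data.Bool using (if_then_else_)
open import Data.Fin using (zero; suc)
open import Data.Fin.Properties using (_≟_; all?; ¬∀⟶∃¬; injective⇒≤; fromℕ<-injective)
open import Data.Fin.Permutation using (transpose; id; _∘ₚ_)
open import Data.Vec using (lookup; head)
open import Data.Vec.Relation.Unary.Unique.Propositional.Properties using (lookup-injective)
import Data.Vec.Relation.Unary.All as VAll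
import Data.Vec.Relation.Unary.AllPairs as AllPairs
open import Data.List using (length)
open import Data.List.Properties using (map-cong-local)
open import Data.List.Membership.Propositional using (_∈_)
open import Data.List.Membership.Propositional.Properties using (∈-filter⁺)
open import Data.List.Relation.Unary.Any using (here; there; any?)
import Data.List.Relation.Unary.Any as Any
import Data.List.Relation.Unary.All as All
open import Data.List.Relation.Binary.Permutation.Propositional
  using (prep; swap; ↭-refl; ↭-trans; ↭-reflexive)
open import Data.Product using (proj₁; proj₂)
open import Data.Sum using (inj₁; inj₂)
open import Data.Empty using (⊥-elim)
open import Function using (_∘_)
open import Function.Bundles using (Injection; _⇔_; mk⇔)
open import Function.Properties.Inverse using (↔⇒↣)
open import Relation.Nullary using (Dec; does; yes; no)
open import Relation.Nullary.Decidable using (dec-true; dec-false; does-⇔)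
open import Relation.Binary.PropositionalEquality using (refl; sym; trans; cong; cong₂; subst; module ≡-Reasoning)

private variable
  n c : ℕ

length≡1⇒∈-unique : {A : Set} {xs : List A} {x y : A} → length xs ≡ 1 → x ∈ xs → y ∈ xs → x ≡ y
length≡1⇒∈-unique {xs = _ ∷ []} _ (here refl) (here refl) = refl
length≡1⇒∈-unique {xs = _ ∷ []} _ _ (there ())
length≡1⇒∈-unique {xs = _ ∷ []} _ (there ()) _

transpose-sends : (i j : Fin n) → transpose i j ⟨$⟩ʳ i ≡ j
transpose-sends i j rewrite dec-true (i ≟ i) refl = refl

transpose-fixes : {i j k : Fin n} → k ≢ i → k ≢ j → transpose i j ⟨$⟩ʳ k ≡ k
transpose-fixes {i = i} {j} {k} k≢i k≢j rewrite dec-false (k ≟ i) k≢i | dec-false (k ≟ j) k≢j = refl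

redirect : Permutation′ n → Fin n → Fin n → Permutation′ n
redirect ρ d t = ρ ∘ₚ transpose (ρ ⟨$⟩ʳ d) t

redirect-sends : (ρ : Permutation′ n) (d t : Fin n) → redirect ρ d t ⟨$⟩ʳ d ≡ t
redirect-sends ρ d t = transpose-sends (ρ ⟨$⟩ʳ d) t

redirect-keeps : (ρ : Permutation′ n) {d t x : Fin n} → x ≢ d → ρ ⟨$⟩ʳ x ≢ t →
                 redirect ρ d t ⟨$⟩ʳ x ≡ ρ ⟨$⟩ʳ x
redirect-keeps ρ x≢d ρx≢t = transpose-fixes (x≢d ∘ Injection.injective (↔⇒↣ ρ)) ρx≢t

permutation-sending₃ : {a b d t₁ t₂ t₃ : Fin n} → a ≢ b → a ≢ d → b ≢ d →
  t₁ ≢ t₂ → t₁ ≢ t₃ → t₂ ≢ t₃ →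
  ∃ λ (π : Permutation′ n) → π ⟨$⟩ʳ a ≡ t₁ × π ⟨$⟩ʳ b ≡ t₂ × π ⟨$⟩ʳ d ≡ t₃
permutation-sending₃ {a = a} {b} {d} {t₁} {t₂} {t₃} a≢b a≢d b≢d t₁≢t₂ t₁≢t₃ t₂≢t₃ =
  ρ₃ , ρ₃a , ρ₃b , redirect-sends ρ₂ d t₃
  where
  ρ₁ = redirect id a t₁
  ρ₂ = redirect ρ₁ b t₂
  ρ₃ = redirect ρ₂ d t₃
  ρ₁a : ρ₁ ⟨$⟩ʳ a ≡ t₁
  ρ₁a = redirect-sends id a t₁
  ρ₂a : ρ₂ ⟨$⟩ʳ a ≡ t₁
  ρ₂a = trans (redirect-keeps ρ₁ a≢b (t₁≢t₂ ∘ trans (sym ρ₁a))) ρ₁a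
  ρ₂b : ρ₂ ⟨$⟩ʳ b ≡ t₂
  ρ₂b = redirect-sends ρ₁ b t₂
  ρ₃a : ρ₃ ⟨$⟩ʳ a ≡ t₁
  ρ₃a = trans (redirect-keeps ρ₂ a≢d (t₁≢t₃ ∘ trans (sym ρ₂a))) ρ₂a
  ρ₃b : ρ₃ ⟨$⟩ʳ b ≡ t₂
  ρ₃b = trans (redirect-keeps ρ₂ b≢d (t₂≢t₃ ∘ trans (sym ρ₂b))) ρ₂b

three-distinct⇒3≤ : {a b d : Fin n} → a ≢ b → a ≢ d → b ≢ d → 3 ≤ n
three-distinct⇒3≤ a≢b a≢d b≢d =
  injective⇒≤ (λ {i} {j} → lookup-injective distinct i j)
  where
  open AllPairs using ([]; _∷_)
  open VAll using ([]; _∷_)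
  distinct = (a≢b ∷ a≢d ∷ []) ∷ (b≢d ∷ []) ∷ [] ∷ []

module _ (h : 3 ≤ c) where
  col1≢col2 : col1 h ≢ col2 h
  col1≢col2 e with fromℕ<-injective 0 1 _ _ e
  ... | ()

  col1≢col3 : col1 h ≢ col3 h
  col1≢col3 e with fromℕ<-injective 0 2 _ _ e
  ... | ()

  col2≢col3 : col2 h ≢ col3 h
  col2≢col3 e with fromℕ<-injective 1 2 _ _ e
  ... | ()

triangle : Fin c → Fin c → Fin c → List (Code 2 c)
triangle a b d = (a ∷ b ∷ []) ∷ (b ∷ d ∷ []) ∷ (d ∷ a ∷ []) ∷ []

triangle-cong : {a b d a' b' d' : Fin c} → a ≡ a' → b ≡ b' → d ≡ d' → triangle a b d ≡ triangle a' b' d'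
triangle-cong refl refl refl = refl

triangle-standard : {a b d : Fin c} → a ≢ b → b ≢ d → d ≢ a →
  Σ (3 ≤ c) λ h → ∃ λ (π : Permutation′ c) →
    map (Data.Vec.map (π ⟨$⟩ʳ_)) (triangle a b d) ≡ triangle (col1 h) (col2 h) (col3 h)
triangle-standard a≢b b≢d d≢a
  with h ← three-distinct⇒3≤ a≢b (d≢a ∘ sym) b≢d
  with π , πa , πb , πd ←
         permutation-sending₃ a≢b (d≢a ∘ sym) b≢d (col1≢col2 h) (col1≢col3 h) (col2≢col3 h)
  = h , π , triangle-cong πa πb πd

module _ {p : ℕ} {S : List (Code p c)} where
  count≡1⇒unique : ∀ {i x} {Q Q' : Code p c} → count S i x ≡ 1 → Q ∈ S → Q' ∈ S →
                   lookup Q i ≡ x → lookup Q' i ≡ x → Q ≡ Q'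
  count≡1⇒unique {i} {x} one Q∈ Q'∈ Qi≡x Q'i≡x =
    length≡1⇒∈-unique one (∈-filter⁺ (λ q → lookup q i ≟ x) Q∈ Qi≡x)
                          (∈-filter⁺ (λ q → lookup q i ≟ x) Q'∈ Q'i≡x)

  ∈⇒Occurs : ∀ {i} {Q : Code p c} → Q ∈ S → Occurs S i (lookup Q i)
  ∈⇒Occurs = Any.map (λ { refl → refl })

  ¬Occurs⇒≢ : ∀ {i x} {Q : Code p c} → ¬ Occurs S i x → Q ∈ S → lookup Q i ≢ x
  ¬Occurs⇒≢ ¬occ Q∈ Qi≡x = ¬occ (Any.map (λ { refl → Qi≡x }) Q∈)

occurs? : {p : ℕ} (S : List (Code p c)) (i : Fin p) (x : Fin c) → Dec (Occurs S i x)
occurs? S i x = any? (λ q → lookup q i ≟ x) S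

match : Fin c → Fin c → ℕ
match x y = if does (x ≟ y) then 1 else 0

match-≢ : {x y : Fin c} → x ≢ y → match x y ≡ 0
match-≢ {x = x} {y} x≢y rewrite dec-false (x ≟ y) x≢y = refl

match-cong : {x y x' y' : Fin c} → x ≡ y ⇔ x' ≡ y' → match x y ≡ match x' y'
match-cong {x = x} {y} {x'} {y'} equiv = cong (if_then 1 else 0) (does-⇔ equiv (x ≟ y) (x' ≟ y'))

answer₂ : (u v x y : Fin c) → answer (u ∷ v ∷ []) (x ∷ y ∷ []) ≡ match u x + match v y
answer₂ u v x y = cong (match u x +_) (+-identityʳ (match v y))

distinct₂ : {x y : Fin c} → x ≢ y → ValidCode (x ∷ y ∷ [])
distinct₂ x≢y = (x≢y ∷ []) ∷ [] ∷ []
  where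
  open AllPairs using ([]; _∷_)
  open VAll using ([]; _∷_)

private variable
  S : List (Code 2 c)
  q q' q₁ q₂ q₃ q₄ : Code 2 c
  a b a' b' x y x' y' : Fin c

IsStrategy⇒≢ : IsStrategy S → (x ∷ y ∷ []) ∈ S → x ≢ y
IsStrategy⇒≢ st Q∈ with All.lookup (proj₁ st) Q∈
... | (x≢y VAll.∷ _) AllPairs.∷ _ = x≢y

Feasible⇒separates : Feasible S → x ≢ y → x' ≢ y' →
  (∀ {u v} → (u ∷ v ∷ []) ∈ S → match u x + match v y ≡ match u x' + match v y') →
  (x ∷ y ∷ []) ≡ (x' ∷ y' ∷ [])
Feasible⇒separates {x = x} {y} {x'} {y'} F x≢y x'≢y' same =
  F _ _ (distinct₂ x≢y) (distinct₂ x'≢y') (map-cong-local (All.tabulate answers))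
  where
  answers : ∀ {Q} → Q ∈ _ → answer Q (x ∷ y ∷ []) ≡ answer Q (x' ∷ y' ∷ [])
  answers {u ∷ v ∷ []} Q∈ = trans (answer₂ u v x y) (trans (same Q∈) (sym (answer₂ u v x' y')))

¬Occurs⇒match≡0 : ∀ {i} {Q : Code 2 c} → ¬ Occurs S i x → Q ∈ S → match (lookup Q i) x ≡ 0
¬Occurs⇒match≡0 ¬occ Q∈ = match-≢ (¬Occurs⇒≢ ¬occ Q∈)

Is11-unique : Is11 S q → ∀ i {Q} → Q ∈ S → lookup Q i ≡ lookup q i → Q ≡ q
Is11-unique {S = S} {q = q} (q∈ , counts) i Q∈ Qi≡qi = count≡1⇒unique (count≡1 i) Q∈ q∈ Qi≡qi refl
  where
  count≡1 : ∀ i → count S i (lookup q i) ≡ 1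
  count≡1 zero       = counts zero
  count≡1 (suc zero) = counts (suc zero)

Is11-≢ : Is11 S q → Is11 S q' → q ≢ q' → ∀ i → lookup q i ≢ lookup q' i
Is11-≢ h h' q≢q' i qi≡q'i = q≢q' (Is11-unique h' i (proj₁ h) qi≡q'i)

Is11-match : Is11 S (a ∷ b ∷ []) → ∀ {u v} → (u ∷ v ∷ []) ∈ S → match u a ≡ match v b
Is11-match h Q∈ = match-cong (mk⇔ (λ u≡a → cong (λ Q → lookup Q (suc zero)) (Is11-unique h zero Q∈ u≡a))
                                  (λ v≡b → cong head (Is11-unique h (suc zero) Q∈ v≡b)))

-- The first question (z|w) supplies the filler for the other peg: z differs from every color
-- missing on peg 1, and w from every color missing on peg 2.
unseen-colors-equal : (S : List (Code 2 c)) → Feasible S → ∀ i →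
                      ¬ Occurs S i x → ¬ Occurs S i y → x ≡ y
unseen-colors-equal {x = x} {y} [] F i _ _ with x ≟ y
... | yes x≡y = x≡y
... | no x≢y  = cong head (F _ _ (distinct₂ x≢y) (distinct₂ (x≢y ∘ sym)) refl)
unseen-colors-equal ((z ∷ _ ∷ []) ∷ _) F zero ¬x ¬y =
  cong head (Feasible⇒separates F (¬Occurs⇒≢ ¬x (here refl) ∘ sym) (¬Occurs⇒≢ ¬y (here refl) ∘ sym)
    λ {_} {v} Q∈ → cong (_+ match v z) (trans (¬Occurs⇒match≡0 ¬x Q∈) (sym (¬Occurs⇒match≡0 ¬y Q∈))))
unseen-colors-equal ((_ ∷ w ∷ []) ∷ _) F (suc zero) ¬x ¬y =
  cong (λ Q → lookup Q (suc zero))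
    (Feasible⇒separates F (¬Occurs⇒≢ ¬x (here refl)) (¬Occurs⇒≢ ¬y (here refl))
      λ {u} Q∈ → cong (match u w +_) (trans (¬Occurs⇒match≡0 ¬x Q∈) (sym (¬Occurs⇒match≡0 ¬y Q∈))))

Is11-¬Disjoint : Feasible S → Is11 S q → Is11 S q' → ¬ Disjoint q q'
Is11-¬Disjoint {q = a ∷ b ∷ []} {q' = a' ∷ b' ∷ []} F h h' disjoint =
  disjoint zero zero
    (cong head (Feasible⇒separates F (disjoint zero (suc zero)) (disjoint (suc zero) zero ∘ sym) same))
  where
  open ≡-Reasoning
  same : ∀ {u v} → (u ∷ v ∷ []) ∈ _ → match u a + match v b' ≡ match u a' + match v b
  same {u} {v} Q∈ = begin
    match u a + match v b'   ≡⟨ cong (_+ match v b') (Is11-match h Q∈) ⟩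
    match v b + match v b'   ≡⟨ +-comm (match v b) (match v b') ⟩
    match v b' + match v b   ≡⟨ cong (_+ match v b) (Is11-match h' Q∈) ⟨
    match u a' + match v b   ∎

Is11-linked : Feasible S → Is11 S (a ∷ b ∷ []) → Is11 S (a' ∷ b' ∷ []) →
              (a ∷ b ∷ []) ≢ (a' ∷ b' ∷ []) → b ≡ a' ⊎ b' ≡ a
Is11-linked {a = a} {b = b} {a' = a'} {b' = b'} F h h' q≢q' with b ≟ a' | b' ≟ a
... | yes b≡a' | _        = inj₁ b≡a'
... | no _     | yes b'≡a = inj₂ b'≡a
... | no b≢a'  | no b'≢a  = ⊥-elim (Is11-¬Disjoint F h h' disjoint)
  where
  disjoint : Disjoint (a ∷ b ∷ []) (a' ∷ b' ∷ [])
  disjoint zero       zero       = Is11-≢ h h' q≢q' zero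
  disjoint zero       (suc zero) = b'≢a ∘ sym
  disjoint (suc zero) zero       = b≢a'
  disjoint (suc zero) (suc zero) = Is11-≢ h h' q≢q' (suc zero)

data Cycle {c : ℕ} : Code 2 c → Code 2 c → Code 2 c → Set where
  cycle : (a b d : Fin c) → Cycle (a ∷ b ∷ []) (b ∷ d ∷ []) (d ∷ a ∷ [])

three-Is11⇒Cycle : Feasible S → q₁ ≢ q₂ → q₁ ≢ q₃ → q₂ ≢ q₃ →
  Is11 S q₁ → Is11 S q₂ → Is11 S q₃ → Cycle q₁ q₂ q₃ ⊎ Cycle q₁ q₃ q₂
three-Is11⇒Cycle {q₁ = _ ∷ _ ∷ []} {q₂ = _ ∷ _ ∷ []} {q₃ = _ ∷ _ ∷ []} F n₁₂ n₁₃ n₂₃ h₁ h₂ h₃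
  with Is11-linked F h₁ h₂ n₁₂ | Is11-linked F h₁ h₃ n₁₃ | Is11-linked F h₂ h₃ n₂₃
... | inj₁ refl | inj₁ refl | _         = ⊥-elim (Is11-≢ h₂ h₃ n₂₃ zero refl)
... | inj₁ refl | inj₂ refl | inj₁ refl = inj₁ (cycle _ _ _)
... | inj₁ refl | inj₂ refl | inj₂ refl = ⊥-elim (Is11-≢ h₁ h₂ n₁₂ zero refl)
... | inj₂ refl | inj₁ refl | inj₁ refl = ⊥-elim (Is11-≢ h₁ h₃ n₁₃ zero refl)
... | inj₂ refl | inj₁ refl | inj₂ refl = inj₂ (cycle _ _ _)
... | inj₂ refl | inj₂ refl | _         = ⊥-elim (Is11-≢ h₂ h₃ n₂₃ (suc zero) refl)

three-Is11-standard : IsStrategy S → Feasible S → q₁ ≢ q₂ → q₁ ≢ q₃ → q₂ ≢ q₃ →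
  Is11 S q₁ → Is11 S q₂ → Is11 S q₃ →
  Σ (3 ≤ c) λ h → ∃ λ (π : Permutation′ c) →
    map (Data.Vec.map (π ⟨$⟩ʳ_)) (q₁ ∷ q₂ ∷ q₃ ∷ []) ↭ (q12 h ∷ q23 h ∷ q31 h ∷ [])
three-Is11-standard st F n₁₂ n₁₃ n₂₃ h₁ h₂ h₃ with three-Is11⇒Cycle F n₁₂ n₁₃ n₂₃ h₁ h₂ h₃
... | inj₁ (cycle _ _ _) =
  let h , π , eq = triangle-standard (IsStrategy⇒≢ st (proj₁ h₁)) (IsStrategy⇒≢ st (proj₁ h₂))
                                     (IsStrategy⇒≢ st (proj₁ h₃))
  in  h , π , ↭-reflexive eq
... | inj₂ (cycle _ _ _) =
  let h , π , eq = triangle-standard (IsStrategy⇒≢ st (proj₁ h₁)) (IsStrategy⇒≢ st (proj₁ h₃))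
                                     (IsStrategy⇒≢ st (proj₁ h₂))
  in  h , π , ↭-trans (prep _ (swap _ _ ↭-refl)) (↭-reflexive eq)

Is11-¬unseen-pair : Feasible S → Is11 S (a ∷ b ∷ []) → Occurs S zero b → Occurs S (suc zero) a →
                    ¬ Occurs S zero x → ¬ Occurs S (suc zero) y → ⊥
Is11-¬unseen-pair {S = S} {a = a} {b = b} {x = x} {y = y} F h b₀ a₁ ¬x ¬y =
  ¬x (subst (Occurs S zero) (sym x≡a) (∈⇒Occurs (proj₁ h)))
  where
  open ≡-Reasoning
  same : ∀ {u v} → (u ∷ v ∷ []) ∈ S → match u x + match v b ≡ match u a + match v y
  same {u} {v} Q∈ = begin
    match u x + match v b   ≡⟨ cong₂ _+_ (¬Occurs⇒match≡0 ¬x Q∈) (sym (Is11-match h Q∈)) ⟩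
    0 + match u a           ≡⟨ +-comm 0 (match u a) ⟩
    match u a + 0           ≡⟨ cong (match u a +_) (¬Occurs⇒match≡0 ¬y Q∈) ⟨
    match u a + match v y   ∎
  x≡a : x ≡ a
  x≡a = cong head (Feasible⇒separates F (λ x≡b → ¬x (subst (Occurs S zero) (sym x≡b) b₀))
                                        (λ a≡y → ¬y (subst (Occurs S (suc zero)) a≡y a₁)) same)

Is11-full-peg : Feasible S → Is11 S (a ∷ b ∷ []) → Occurs S zero b → Occurs S (suc zero) a →
                Σ (Fin 2) λ i → (x : Fin c) → Occurs S i x
Is11-full-peg {S = S} F h b₀ a₁ with all? (occurs? S zero) | all? (occurs? S (suc zero))
... | yes all₀ | _        = zero , all₀
... | no _     | yes all₁ = suc zero , all₁
... | no ¬all₀ | no ¬all₁ =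
  ⊥-elim (Is11-¬unseen-pair F h b₀ a₁ (proj₂ (¬∀⟶∃¬ _ _ (occurs? S zero) ¬all₀))
                                      (proj₂ (¬∀⟶∃¬ _ _ (occurs? S (suc zero)) ¬all₁)))

three-Is11-full-peg : Feasible S → q₁ ≢ q₂ → q₁ ≢ q₃ → q₂ ≢ q₃ →
  Is11 S q₁ → Is11 S q₂ → Is11 S q₃ → Σ (Fin 2) λ i → (x : Fin c) → Occurs S i x
three-Is11-full-peg F n₁₂ n₁₃ n₂₃ h₁ h₂ h₃ with three-Is11⇒Cycle F n₁₂ n₁₃ n₂₃ h₁ h₂ h₃
... | inj₁ (cycle _ _ _) = Is11-full-peg F h₁ (∈⇒Occurs (proj₁ h₂)) (∈⇒Occurs (proj₁ h₃))
... | inj₂ (cycle _ _ _) = Is11-full-peg F h₁ (∈⇒Occurs (proj₁ h₃)) (∈⇒Occurs (proj₁ h₂))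

¬four-Is11 : Feasible S → q₁ ≢ q₂ → q₁ ≢ q₃ → q₁ ≢ q₄ → q₂ ≢ q₃ → q₂ ≢ q₄ → q₃ ≢ q₄ →
  Is11 S q₁ → Is11 S q₂ → Is11 S q₃ → Is11 S q₄ → ⊥
¬four-Is11 F n₁₂ n₁₃ n₁₄ n₂₃ n₂₄ n₃₄ h₁ h₂ h₃ h₄
  with three-Is11⇒Cycle F n₁₂ n₁₃ n₂₃ h₁ h₂ h₃ | three-Is11⇒Cycle F n₁₂ n₁₄ n₂₄ h₁ h₂ h₄
... | inj₁ (cycle _ _ _) | inj₁ (cycle _ _ _) = n₃₄ refl
... | inj₂ (cycle _ _ _) | inj₂ (cycle _ _ _) = n₃₄ refl
-- In the mixed orientations q₂ shares its first color with q₄, resp. q₃.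
... | inj₁ (cycle _ _ _) | inj₂ (cycle _ _ _) = Is11-≢ h₂ h₄ n₂₄ zero refl
... | inj₂ (cycle _ _ _) | inj₁ (cycle _ _ _) = Is11-≢ h₂ h₃ n₂₃ zero refl

lemma1 : (c : ℕ) → 2 ≤ c →
    -- (a)
    ((S : List (Code 2 c)) → IsStrategy S → Feasible S →
      (i : Fin 2) (x y : Fin c) → ¬ Occurs S i x → ¬ Occurs S i y → x ≡ y)
    ×
    -- (b)
    ((S : List (Code 2 c)) → IsStrategy S → Feasible S →
      (q q' : Code 2 c) → Is11 S q → Is11 S q' → ¬ Disjoint q q')
    ×
    -- (c)
    ((S : List (Code 2 c)) → IsStrategy S → Feasible S →
      (q₁ q₂ q₃ : Code 2 c) → q₁ ≢ q₂ → q₁ ≢ q₃ → q₂ ≢ q₃ →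
      Is11 S q₁ → Is11 S q₂ → Is11 S q₃ →
      Σ (3 ≤ c) λ h → ∃ λ (π : Permutation′ c) →
        map (Data.Vec.map (π ⟨$⟩ʳ_)) (q₁ ∷ q₂ ∷ q₃ ∷ []) ↭ (q12 h ∷ q23 h ∷ q31 h ∷ []))
    ×
    -- (d)
    ((S : List (Code 2 c)) → IsStrategy S → Feasible S →
      (q₁ q₂ q₃ : Code 2 c) → q₁ ≢ q₂ → q₁ ≢ q₃ → q₂ ≢ q₃ →
      Is11 S q₁ → Is11 S q₂ → Is11 S q₃ →
      Σ (Fin 2) λ i → (x : Fin c) → Occurs S i x)
    ×
    -- (e)
    ((S : List (Code 2 c)) → IsStrategy S → Feasible S →
      (q₁ q₂ q₃ q₄ : Code 2 c) → q₁ ≢ q₂ → q₁ ≢ q₃ → q₁ ≢ q₄ → q₂ ≢ q₃ → q₂ ≢ q₄ → q₃ ≢ q₄ →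
      Is11 S q₁ → Is11 S q₂ → Is11 S q₃ → Is11 S q₄ → ⊥)
lemma1 _ _ =
  (λ S _ F i _ _ → unseen-colors-equal S F i) ,
  (λ _ _ F _ _ → Is11-¬Disjoint F) ,
  (λ _ st F _ _ _ → three-Is11-standard st F) ,
  (λ _ _ F _ _ _ → three-Is11-full-peg F) ,
  (λ _ _ F _ _ _ _ → ¬four-Is11 F)
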